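{- Let $n$ and $k$ be positive integers with $n\geq 2k$ and $\gcd(n,k)=2$, and let $t$ be the minimum positive integer such that $tk\equiv 2 \pmod{n}$. Then $GP(n,k)$ admits a 5-star edge coloring in each of the following cases: (1) $n\equiv 0\pmod 6$; (2) $n\equiv 2\pmod 6$ and $t\equiv 2\pmod 3$; (3) $n\equiv 4\pmod 6$ and $t\equiv 1\pmod 3$.
   Context: For integers $n,k$ with $n\geq 2k\geq 2$, the generalized Petersen graph $GP(n,k)$ is the simple graph with vertex set $\{u_0,\ldots,u_{n-1}\}\cup\{v_0,\ldots,v_{n-1}\}$ and edge set $\{u_iu_{i+1}:0\le i\le n-1\}\cup\{v_iv_{i+k}:0\le i\le n-1\}\cup\{u_iv_i:0\le i\le n-1\}$, indices taken modulo $n$. A $5$-star edge coloring of a graph is a proper edge coloring using at most $5$ colors such that no path and no cycle with four edges is bicolored (i.e. colored with only two colors). -}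

module Defs where

open import Data.Nat using (ℕ; suc; _+_; _%_; NonZero)
open import Data.Fin using (Fin; toℕ)
open import Data.Product using (_×_; ∃₂)
open import Data.Sum using (_⊎_)
open import Data.Empty using (⊥)
open import Relation.Binary.PropositionalEquality using (_≡_; _≢_)
open import Relation.Nullary using (¬_)

data Vertex (n : ℕ) : Set where
  u : Fin n → Vertex n
  v : Fin n → Vertex n

_≡_+_mod_ : {n : ℕ} → Fin n → Fin n → ℕ → (n' : ℕ) → .{{NonZero n'}} → Set
j ≡ i + d mod n' = toℕ j ≡ (toℕ i + d) % n'

Adj : (n k : ℕ) → .{{NonZero n}} → Vertex n → Vertex n → Set
Adj n k (u i) (u j) = (j ≡ i + 1 mod n) ⊎ (i ≡ j + 1 mod n)
Adj n k (v i) (v j) = (j ≡ i + k mod n) ⊎ (i ≡ j + k mod n)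
Adj n k (u i) (v j) = i ≡ j
Adj n k (v i) (u j) = i ≡ j

-- An edge colouring with colours in Fin c, given as a colour assigned to every
-- ordered pair of vertices; only the values on adjacent pairs matter, and these
-- must be symmetric (so that it is a colouring of undirected edges).
record EdgeColouring (n k : ℕ) .{{_ : NonZero n}} (c : ℕ) : Set where
  field
    col : Vertex n → Vertex n → Fin c
    sym : ∀ x y → Adj n k x y → col x y ≡ col y x

open EdgeColouring public

Proper : {n k c : ℕ} .{{_ : NonZero n}} → EdgeColouring n k c → Set
Proper {n} {k} φ = ∀ x y z → Adj n k x y → Adj n k y z → x ≢ z →
  col φ x y ≢ col φ y z

InTwo : {c : ℕ} → Fin c → Fin c → Fin c → Set
InTwo a b e = (e ≡ a) ⊎ (e ≡ b)

IsPath4 : (n k : ℕ) .{{_ : NonZero n}} → (x0 x1 x2 x3 x4 : Vertex n) → Set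
IsPath4 n k x0 x1 x2 x3 x4 =
  Adj n k x0 x1 × Adj n k x1 x2 × Adj n k x2 x3 × Adj n k x3 x4 ×
  x0 ≢ x1 × x0 ≢ x2 × x0 ≢ x3 × x0 ≢ x4 ×
  x1 ≢ x2 × x1 ≢ x3 × x1 ≢ x4 ×
  x2 ≢ x3 × x2 ≢ x4 ×
  x3 ≢ x4

IsCycle4 : (n k : ℕ) .{{_ : NonZero n}} → (x0 x1 x2 x3 : Vertex n) → Set
IsCycle4 n k x0 x1 x2 x3 =
  Adj n k x0 x1 × Adj n k x1 x2 × Adj n k x2 x3 × Adj n k x3 x0 ×
  x0 ≢ x1 × x0 ≢ x2 × x0 ≢ x3 ×
  x1 ≢ x2 × x1 ≢ x3 ×
  x2 ≢ x3

NoBicoloured4 : {n k c : ℕ} .{{_ : NonZero n}} → EdgeColouring n k c → Set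
NoBicoloured4 {n} {k} {c} φ =
  (∀ x0 x1 x2 x3 x4 → IsPath4 n k x0 x1 x2 x3 x4 →
     ¬ ∃₂ λ (a b : Fin c) →
         InTwo a b (col φ x0 x1) × InTwo a b (col φ x1 x2) ×
         InTwo a b (col φ x2 x3) × InTwo a b (col φ x3 x4)) ×
  (∀ x0 x1 x2 x3 → IsCycle4 n k x0 x1 x2 x3 →
     ¬ ∃₂ λ (a b : Fin c) →
         InTwo a b (col φ x0 x1) × InTwo a b (col φ x1 x2) ×
         InTwo a b (col φ x2 x3) × InTwo a b (col φ x3 x0))

record StarEdgeColouring5 (n k : ℕ) .{{_ : NonZero n}} : Set where
  field
    colouring : EdgeColouring n k 5
    proper    : Proper colouring
    star      : NoBicoloured4 colouring

{-# OPTIONS --safe #-}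

-- Both n = 2m and k = 2h are even, t k ≡ 2 (mod n) gives h t ≡ 1 (mod m), and minimality of t
-- gives t < m.  Give an index p = 2a + b the parity b and the position a t mod m.  An inner edge
-- v_p v_(p+k) keeps the parity and advances the position by one, so the inner vertices of each
-- parity form an m-cycle ordered by position; an outer edge u_p u_(p+1) keeps the position when p
-- is even and advances it by t when p is odd.  Label each position by whether it is 0, m − 1 or
-- m − 2, and otherwise by its residue mod 3.  The colour of an edge is read off from the side,
-- parity and labels of its ends, i.e. the colouring is pulled back from a colouring of a finite
-- pattern graph with 24 nodes and three ports (forward, backward, spoke) per node.  The map to the
-- pattern is injective on the edges at each vertex, so a walk x₀ … x₄ with x_i ≠ x_(i+2) maps to a
-- non-backtracking walk of the pattern.  In a proper colouring a bicoloured path or cycle with four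
-- edges is such a walk with alternating colours, and for each of the five pattern colourings
-- (m mod 3 and t mod 3 as the hypotheses allow, and GP(4,2)) evaluation shows that it is proper
-- and admits no alternating walk.

module Submission where

open import Defs
open import Data.Nat using (ℕ; zero; suc; _+_; _*_; _∸_; _%_; _/_; _≤_; _<_; _≡ᵇ_; z≤n; s≤s; s≤s⁻¹; NonZero; >-nonZero; >-nonZero⁻¹; ⌊_/2⌋; parity)
open import Data.Nat.Properties
open import Data.Nat.DivMod
open import Data.Nat.Divisibility using (_∣_; divides; ∣⇒≤; ∣-refl; m%n≡0⇒n∣m)
open import Data.Nat.GCD using (gcd; gcd[m,n]∣m; gcd[m,n]∣n; gcd-greatest)
open import Data.Nat.Tactic.RingSolver using (solve-∀)
open import Data.Bool using (Bool; true; false; _∧_; _∨_; not; T; if_then_else_)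
open import Data.Bool.Properties using (T-∧; T-∨)
open import Data.Unit using (tt)
open import Data.Fin using (Fin; #_; toℕ)
open import Data.Fin.Properties using (toℕ-injective; toℕ<n) renaming (_≟_ to _≟ᶠ_)
open import Data.List using (List; []; _∷_; map; filter; _++_; cartesianProduct)
open import Data.List.Relation.Unary.All using (All; all?; lookup)
open import Data.List.Relation.Unary.Any using (here; there)
open import Data.List.Membership.Propositional using (_∈_)
open import Data.List.Membership.Propositional.Properties using (∈-map⁺; ∈-filter⁺; ∈-cartesianProduct⁺; ∈-++⁺ˡ; ∈-++⁺ʳ)
open import Data.Parity.Base using (Parity; 0ℙ; 1ℙ)
open import Data.Product using (_×_; _,_; ∃-syntax)
open import Data.Sum using (_⊎_; inj₁; inj₂; [_,_])
open import Data.Empty using (⊥; ⊥-elim)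
open import Function using (_∘_)
open import Function.Bundles using (Equivalence)
open import Relation.Nullary using (¬_; yes; no; does; contradiction)
open import Relation.Nullary.Decidable using (Dec; _×-dec_; _→-dec_; ¬?; T?; from-yes; map′; dec-true; dec-false)
open import Relation.Binary.PropositionalEquality as ≡ using (_≡_; _≢_; refl; cong; cong₂; trans; subst; subst₂)

-- Bicoloured walks

NoAlternating4Walk : {V : Set} {c : ℕ} → (V → V → Set) → (V → V → Fin c) → Set
NoAlternating4Walk Adj col = ∀ x₀ x₁ x₂ x₃ x₄ → Adj x₀ x₁ → Adj x₁ x₂ → Adj x₂ x₃ → Adj x₃ x₄ →
  x₀ ≢ x₂ → x₁ ≢ x₃ → x₂ ≢ x₄ → col x₂ x₃ ≡ col x₀ x₁ → col x₃ x₄ ≢ col x₁ x₂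

InTwo-alternates : ∀ {c} {a b x y z : Fin c} → InTwo a b x → InTwo a b y → InTwo a b z → x ≢ y → y ≢ z → z ≡ x
InTwo-alternates (inj₁ refl) (inj₁ refl) _           x≢y _   = contradiction refl x≢y
InTwo-alternates (inj₂ refl) (inj₂ refl) _           x≢y _   = contradiction refl x≢y
InTwo-alternates (inj₁ refl) (inj₂ refl) (inj₁ refl) _   _   = refl
InTwo-alternates (inj₂ refl) (inj₁ refl) (inj₂ refl) _   _   = refl
InTwo-alternates _           (inj₁ refl) (inj₁ refl) _   y≢z = contradiction refl y≢z
InTwo-alternates _           (inj₂ refl) (inj₂ refl) _   y≢z = contradiction refl y≢z

noBicoloured4 : ∀ {n k c} .{{_ : NonZero n}} (φ : EdgeColouring n k c) → Proper φ →
  NoAlternating4Walk (Adj n k) (col φ) → NoBicoloured4 φ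
noBicoloured4 {n} {k} {c} φ proper noAlternating =
  (λ { x₀ x₁ x₂ x₃ x₄ (x₀₁ , x₁₂ , x₂₃ , x₃₄ , _ , x₀≢x₂ , _ , _ , _ , x₁≢x₃ , _ , _ , x₂≢x₄ , _)
         (_ , _ , c₁ , c₂ , c₃ , c₄) →
       bicoloured-walk x₀₁ x₁₂ x₂₃ x₃₄ x₀≢x₂ x₁≢x₃ x₂≢x₄ c₁ c₂ c₃ c₄ }) ,
  (λ { x₀ x₁ x₂ x₃ (x₀₁ , x₁₂ , x₂₃ , x₃₀ , _ , x₀≢x₂ , _ , _ , x₁≢x₃ , _)
         (_ , _ , c₁ , c₂ , c₃ , c₄) →
       bicoloured-walk x₀₁ x₁₂ x₂₃ x₃₀ x₀≢x₂ x₁≢x₃ (x₀≢x₂ ∘ ≡.sym) c₁ c₂ c₃ c₄ })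
  where
  bicoloured-walk : ∀ {a b : Fin c} {x₀ x₁ x₂ x₃ x₄} →
    Adj n k x₀ x₁ → Adj n k x₁ x₂ → Adj n k x₂ x₃ → Adj n k x₃ x₄ → x₀ ≢ x₂ → x₁ ≢ x₃ → x₂ ≢ x₄ →
    InTwo a b (col φ x₀ x₁) → InTwo a b (col φ x₁ x₂) → InTwo a b (col φ x₂ x₃) → InTwo a b (col φ x₃ x₄) →
    ⊥
  bicoloured-walk x₀₁ x₁₂ x₂₃ x₃₄ x₀≢x₂ x₁≢x₃ x₂≢x₄ c₁ c₂ c₃ c₄ =
    noAlternating _ _ _ _ _ x₀₁ x₁₂ x₂₃ x₃₄ x₀≢x₂ x₁≢x₃ x₂≢x₄
      (InTwo-alternates c₁ c₂ c₃ (proper _ _ _ x₀₁ x₁₂ x₀≢x₂) (proper _ _ _ x₁₂ x₂₃ x₁≢x₃))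
      (InTwo-alternates c₂ c₃ c₄ (proper _ _ _ x₁₂ x₂₃ x₁≢x₃) (proper _ _ _ x₂₃ x₃₄ x₂≢x₄))

-- Colourings pulled back from a pattern of darts

infixl 5 _!_
_!_ : ∀ {A : Set} {P : A → Set} {xs x} → All P xs → x ∈ xs → P x
ps ! x∈xs = lookup ps x∈xs

All-syntax : {A : Set} → List A → (A → Set) → Set
All-syntax xs P = All P xs

infixr 1 All-syntax
syntax All-syntax xs (λ x → P) = All[ x ∈ xs ] P

module DartColouring {c : ℕ} {Dart : Set} (darts : List Dart) (links turns : Dart → List Dart)
  (colour : Dart → Dart → Fin c) where

  Symmetric : Set
  Symmetric = All[ d ∈ darts ] All[ e ∈ links d ] colour d e ≡ colour e d

  ProperAtTurns : Set
  ProperAtTurns = All[ d ∈ darts ] All[ e ∈ links d ] All[ d′ ∈ turns d ] All[ e′ ∈ links d′ ]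
    colour d e ≢ colour d′ e′

  NoAlternatingWalk : Set
  NoAlternatingWalk =
    All[ d₀ ∈ darts ] All[ e₁ ∈ links d₀ ] All[ d₁ ∈ turns e₁ ] All[ e₂ ∈ links d₁ ]
    All[ d₂ ∈ turns e₂ ] All[ e₃ ∈ links d₂ ] (colour d₂ e₃ ≡ colour d₀ e₁ →
    All[ d₃ ∈ turns e₃ ] All[ e₄ ∈ links d₃ ] colour d₃ e₄ ≢ colour d₁ e₂)

  record Valid : Set where
    constructor mkValid
    field
      symmetric     : Symmetric
      properAtTurns : ProperAtTurns
      noAlternating : NoAlternatingWalk

  valid? : Dec Valid
  valid? = map′ (λ (s , p , a) → mkValid s p a) (λ (mkValid s p a) → s , p , a)
    (symmetric? ×-dec proper? ×-dec noAlternating?)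
    where
    symmetric? = all? (λ d → all? (λ e → colour d e ≟ᶠ colour e d) (links d)) darts
    proper? = all? (λ d → all? (λ e → all? (λ d′ → all? (λ e′ → ¬? (colour d e ≟ᶠ colour d′ e′))
                (links d′)) (turns d)) (links d)) darts
    noAlternating? =
      all? (λ d₀ → all? (λ e₁ → all? (λ d₁ → all? (λ e₂ → all? (λ d₂ → all? (λ e₃ →
        colour d₂ e₃ ≟ᶠ colour d₀ e₁ →-dec
        all? (λ d₃ → all? (λ e₄ → ¬? (colour d₃ e₄ ≟ᶠ colour d₁ e₂))
          (links d₃)) (turns e₃))
        (links d₂)) (turns e₂)) (links d₁)) (turns e₁)) (links d₀)) darts

  module Lift (valid : Valid) {V : Set} (Adj : V → V → Set) (Adj-sym : ∀ {x y} → Adj x y → Adj y x)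
    (dart : V → V → Dart) (dart∈darts : ∀ x y → dart x y ∈ darts)
    (link : ∀ {x y} → Adj x y → dart y x ∈ links (dart x y))
    (turn : ∀ {x y z} → Adj x y → Adj x z → y ≢ z → dart x z ∈ turns (dart x y)) where

    open Valid valid

    lifted : V → V → Fin c
    lifted x y = colour (dart x y) (dart y x)

    lifted-sym : ∀ x y → Adj x y → lifted x y ≡ lifted y x
    lifted-sym x y x~y = symmetric ! dart∈darts x y ! link x~y

    lifted-proper : ∀ x y z → Adj x y → Adj y z → x ≢ z → lifted x y ≢ lifted y z
    lifted-proper x y z x~y y~z x≢z =
      (properAtTurns ! dart∈darts y x ! link (Adj-sym x~y) ! turn (Adj-sym x~y) y~z x≢z ! link y~z)
      ∘ trans (lifted-sym y x (Adj-sym x~y))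

    lifted-noAlternating : NoAlternating4Walk Adj lifted
    lifted-noAlternating x₀ x₁ x₂ x₃ x₄ x₀~x₁ x₁~x₂ x₂~x₃ x₃~x₄ x₀≢x₂ x₁≢x₃ x₂≢x₄ repeated =
      (noAlternating ! dart∈darts x₀ x₁ ! link x₀~x₁ ! turn (Adj-sym x₀~x₁) x₁~x₂ x₀≢x₂ ! link x₁~x₂
        ! turn (Adj-sym x₁~x₂) x₂~x₃ x₁≢x₃ ! link x₂~x₃) repeated
        ! turn (Adj-sym x₂~x₃) x₃~x₄ x₂≢x₄ ! link x₃~x₄

-- The pattern

data Side : Set where
  outer inner : Side

-- The label of a position j < m: F0 for j = 0, else E1 for j = m − 1, E2 for j = m − 2, and
-- R0, R1, R2 by the residue of j mod 3.
data Label : Set where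
  F0 E1 E2 R0 R1 R2 : Label

data Port : Set where
  forward backward spoke : Port

data Node : Set where
  node : Side → Parity → Label → Node

Dart : Set
Dart = Node × Port

labels : List Label
labels = F0 ∷ E1 ∷ E2 ∷ R0 ∷ R1 ∷ R2 ∷ []

ports : List Port
ports = forward ∷ backward ∷ spoke ∷ []

nodes : List Node
nodes = map (λ ((s , π) , l) → node s π l)
  (cartesianProduct (cartesianProduct (outer ∷ inner ∷ []) (0ℙ ∷ 1ℙ ∷ [])) labels)

darts : List Dart
darts = cartesianProduct nodes ports

opposite : Side → Side
opposite outer = inner
opposite inner = outer

otherPorts : Port → List Port
otherPorts forward  = backward ∷ spoke ∷ []
otherPorts backward = forward ∷ spoke ∷ []
otherPorts spoke    = forward ∷ backward ∷ []

turns : Dart → List Dart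
turns (x , P) = map (x ,_) (otherPorts P)

∈-labels : ∀ l → l ∈ labels
∈-labels F0 = here refl
∈-labels E1 = there (here refl)
∈-labels E2 = there (there (here refl))
∈-labels R0 = there (there (there (here refl)))
∈-labels R1 = there (there (there (there (here refl))))
∈-labels R2 = there (there (there (there (there (here refl)))))

∈-darts : ∀ d → d ∈ darts
∈-darts (node s π l , P) =
  ∈-cartesianProduct⁺ (∈-map⁺ (λ ((s , π) , l) → node s π l)
    (∈-cartesianProduct⁺ (∈-cartesianProduct⁺ (∈-sides s) (∈-parities π)) (∈-labels l))) (∈-ports P)
  where
  ∈-sides : ∀ s → s ∈ outer ∷ inner ∷ []
  ∈-sides outer = here refl
  ∈-sides inner = there (here refl)
  ∈-parities : ∀ π → π ∈ 0ℙ ∷ 1ℙ ∷ []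
  ∈-parities 0ℙ = here refl
  ∈-parities 1ℙ = there (here refl)
  ∈-ports : ∀ P → P ∈ ports
  ∈-ports forward  = here refl
  ∈-ports backward = there (here refl)
  ∈-ports spoke    = there (there (here refl))

∈-turns : ∀ {x P Q} → P ≢ Q → (x , Q) ∈ turns (x , P)
∈-turns {x} {P} {Q} P≢Q = ∈-map⁺ (x ,_) (∈-otherPorts P Q P≢Q)
  where
  ∈-otherPorts : ∀ P Q → P ≢ Q → Q ∈ otherPorts P
  ∈-otherPorts forward  forward  P≢Q = ⊥-elim (P≢Q refl)
  ∈-otherPorts forward  backward _   = here refl
  ∈-otherPorts forward  spoke    _   = there (here refl)
  ∈-otherPorts backward forward  _   = here refl
  ∈-otherPorts backward backward P≢Q = ⊥-elim (P≢Q refl)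
  ∈-otherPorts backward spoke    _   = there (here refl)
  ∈-otherPorts spoke    forward  _   = here refl
  ∈-otherPorts spoke    backward _   = there (here refl)
  ∈-otherPorts spoke    spoke    P≢Q = ⊥-elim (P≢Q refl)

-- The residue mod 3 of any position carrying the label, when m ≡ μ (mod 3).
residue : ℕ → Label → ℕ
residue μ F0 = 0
residue μ E1 = (μ + 2) % 3
residue μ E2 = (μ + 1) % 3
residue μ R0 = 0
residue μ R1 = 1
residue μ R2 = 2

isF0 isE1 isE2 : Label → Bool
isF0 F0 = true
isF0 _  = false
isE1 E1 = true
isE1 _  = false
isE2 E2 = true
isE2 _  = false

_⇒ᵇ_ : Bool → Bool → Bool
a ⇒ᵇ b = not a ∨ b

-- Constraints on the labels of positions j and j + t mod m, according as j + t < m or not.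
outerStepWithin outerStepWrapping outerStep : ℕ → ℕ → Label → Label → Bool
outerStepWithin μ τ l l′ =
  (residue μ l′ ≡ᵇ (residue μ l + τ) % 3) ∧ not (isF0 l′) ∧ not (isE1 l) ∧ (isE2 l ⇒ᵇ isE1 l′)
outerStepWrapping μ τ l l′ =
  ((residue μ l′ + μ) % 3 ≡ᵇ (residue μ l + τ) % 3) ∧ not (isF0 l) ∧ not (isE1 l′) ∧ (isE2 l′ ⇒ᵇ isE1 l)
outerStep μ τ l l′ = outerStepWithin μ τ l l′ ∨ outerStepWrapping μ τ l l′

-- Constraints on the labels of positions j and j + 1 mod m, for m ≥ 3.
innerStep : ℕ → Label → Label → Bool
innerStep μ E1 F0 = true
innerStep μ E2 E1 = true
innerStep μ F0 E2 = μ ≡ᵇ 0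
innerStep μ F0 R1 = true
innerStep μ R0 R1 = true
innerStep μ R1 R2 = true
innerStep μ R2 R0 = true
innerStep μ R0 E2 = μ ≡ᵇ 0
innerStep μ R1 E2 = μ ≡ᵇ 1
innerStep μ R2 E2 = μ ≡ᵇ 2
innerStep μ _  _  = false

swapsF0E1 : Label → Label → Bool
swapsF0E1 F0 E1 = true
swapsF0E1 E1 F0 = true
swapsF0E1 _  _  = false

-- μ = m mod 3 and τ = t mod 3.  In GP(4,2) each inner edge v_i v_(i+2) is a forward step from
-- both of its ends.
data Case : Set where
  μ0τ1 μ0τ2 μ1τ2 μ2τ1 gp42 : Case

outerLink innerLink degenerateLink : Case → Label → Label → Bool
outerLink μ0τ1 = outerStep 0 1
outerLink μ0τ2 = outerStep 0 2
outerLink μ1τ2 = outerStep 1 2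
outerLink μ2τ1 = outerStep 2 1
outerLink gp42 = swapsF0E1
innerLink μ0τ1 = innerStep 0
innerLink μ0τ2 = innerStep 0
innerLink μ1τ2 = innerStep 1
innerLink μ2τ1 = innerStep 2
innerLink gp42 _ _ = false
degenerateLink gp42 = swapsF0E1
degenerateLink _ _ _ = false

dartsWhere : (Label → Bool) → (Label → Node) → Port → List Dart
dartsWhere p x P = map (λ l → x l , P) (filter (λ l → T? (p l)) labels)

∈-dartsWhere : ∀ p {x P l} → T (p l) → (x l , P) ∈ dartsWhere p x P
∈-dartsWhere p {x} {P} {l} pl = ∈-map⁺ (λ l → x l , P) (∈-filter⁺ (λ l → T? (p l)) (∈-labels l) pl)

links : Case → Dart → List Dart
links c (node s π l , spoke) = (node (opposite s) π l , spoke) ∷ []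
links c (node outer 0ℙ l , forward)  = (node outer 1ℙ l , backward) ∷ []
links c (node outer 1ℙ l , forward)  = dartsWhere (outerLink c l) (node outer 0ℙ) backward
links c (node outer 0ℙ l , backward) = dartsWhere (λ l′ → outerLink c l′ l) (node outer 1ℙ) forward
links c (node outer 1ℙ l , backward) = (node outer 0ℙ l , forward) ∷ []
links c (node inner π l , forward)   =
  dartsWhere (innerLink c l) (node inner π) backward ++ dartsWhere (degenerateLink c l) (node inner π) forward
links c (node inner π l , backward)  = dartsWhere (λ l′ → innerLink c l′ l) (node inner π) forward

byLabel : (f e₁ e₂ r₀ r₁ r₂ : Fin 5) → Label → Fin 5
byLabel f e₁ e₂ r₀ r₁ r₂ F0 = f
byLabel f e₁ e₂ r₀ r₁ r₂ E1 = e₁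
byLabel f e₁ e₂ r₀ r₁ r₂ E2 = e₂
byLabel f e₁ e₂ r₀ r₁ r₂ R0 = r₀
byLabel f e₁ e₂ r₀ r₁ r₂ R1 = r₁
byLabel f e₁ e₂ r₀ r₁ r₂ R2 = r₂

spokeColour : Case → Parity → Label → Fin 5
spokeColour μ0τ1 _  = byLabel (# 1) (# 1) (# 1) (# 0) (# 0) (# 0)
spokeColour μ0τ2 _  = byLabel (# 1) (# 1) (# 1) (# 0) (# 0) (# 0)
spokeColour μ1τ2 _  = byLabel (# 1) (# 1) (# 1) (# 1) (# 1) (# 1)
spokeColour μ2τ1 0ℙ = byLabel (# 1) (# 2) (# 1) (# 1) (# 1) (# 0)
spokeColour μ2τ1 1ℙ = byLabel (# 2) (# 3) (# 2) (# 2) (# 2) (# 1)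
spokeColour gp42 0ℙ = byLabel (# 2) (# 0) (# 1) (# 1) (# 1) (# 1)
spokeColour gp42 1ℙ = byLabel (# 1) (# 2) (# 2) (# 2) (# 2) (# 2)

innerColour : Case → Parity → Label → Fin 5
innerColour μ0τ1 0ℙ = byLabel (# 4) (# 2) (# 3) (# 4) (# 3) (# 2)
innerColour μ0τ1 1ℙ = byLabel (# 3) (# 4) (# 2) (# 3) (# 2) (# 4)
innerColour μ0τ2 0ℙ = byLabel (# 4) (# 2) (# 3) (# 4) (# 3) (# 2)
innerColour μ0τ2 1ℙ = byLabel (# 2) (# 3) (# 4) (# 2) (# 4) (# 3)
innerColour μ1τ2 _  = byLabel (# 2) (# 3) (# 4) (# 2) (# 3) (# 4)
innerColour μ2τ1 0ℙ = byLabel (# 2) (# 0) (# 4) (# 2) (# 4) (# 3)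
innerColour μ2τ1 1ℙ = byLabel (# 1) (# 4) (# 0) (# 1) (# 3) (# 4)
innerColour gp42 0ℙ _ = # 1
innerColour gp42 1ℙ _ = # 0

outerColour : Case → Parity → Label → Label → Fin 5
outerColour μ0τ1 0ℙ l _ = byLabel (# 0) (# 0) (# 0) (# 1) (# 1) (# 1) l
outerColour μ0τ1 1ℙ l _ = byLabel (# 2) (# 3) (# 4) (# 2) (# 4) (# 3) l
outerColour μ0τ2 0ℙ l _ = byLabel (# 0) (# 0) (# 0) (# 1) (# 1) (# 1) l
outerColour μ0τ2 1ℙ l _ = byLabel (# 4) (# 2) (# 3) (# 4) (# 3) (# 2) l
outerColour μ1τ2 0ℙ l _ = byLabel (# 4) (# 2) (# 2) (# 3) (# 4) (# 2) l
outerColour μ1τ2 1ℙ _ _ = # 0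
outerColour μ2τ1 0ℙ l _ = byLabel (# 0) (# 1) (# 4) (# 4) (# 3) (# 2) l
outerColour μ2τ1 1ℙ F0 E1 = # 3
outerColour μ2τ1 1ℙ F0 _  = # 4
outerColour μ2τ1 1ℙ E1 F0 = # 4
outerColour μ2τ1 1ℙ E1 _  = # 0
outerColour μ2τ1 1ℙ E2 _  = # 3
outerColour μ2τ1 1ℙ R0 R1 = # 0
outerColour μ2τ1 1ℙ R0 _  = # 3
outerColour μ2τ1 1ℙ R1 R0 = # 0
outerColour μ2τ1 1ℙ R1 _  = # 4
outerColour μ2τ1 1ℙ R2 _  = # 0
outerColour gp42 0ℙ l _ = byLabel (# 0) (# 1) (# 0) (# 0) (# 0) (# 0) l
outerColour gp42 1ℙ l _ = byLabel (# 4) (# 3) (# 0) (# 0) (# 0) (# 0) l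

stepColour : Case → Node → Node → Fin 5
stepColour c (node outer π l) (node _ _ l′) = outerColour c π l l′
stepColour c (node inner π l) _             = innerColour c π l

colour : Case → Dart → Dart → Fin 5
colour c (node _ π l , spoke) _ = spokeColour c π l
colour c (x , forward)  (y , _) = stepColour c x y
colour c (x , backward) (y , _) = stepColour c y x

module Pattern (c : Case) = DartColouring darts (links c) turns (colour c)

valid : ∀ c → Pattern.Valid c
valid μ0τ1 = from-yes (Pattern.valid? μ0τ1)
valid μ0τ2 = from-yes (Pattern.valid? μ0τ2)
valid μ1τ2 = from-yes (Pattern.valid? μ1τ2)
valid μ2τ1 = from-yes (Pattern.valid? μ2τ1)
valid gp42 = from-yes (Pattern.valid? gp42)

-- Arithmetic modulo n = m + m

bit : Parity → ℕ
bit 0ℙ = 0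
bit 1ℙ = 1

bit≤1 : ∀ π → bit π ≤ 1
bit≤1 0ℙ = z≤n
bit≤1 1ℙ = s≤s z≤n

[1+a]+[1+a]+b≡2+[a+a+b] : ∀ a b → suc a + suc a + b ≡ suc (suc (a + a + b))
[1+a]+[1+a]+b≡2+[a+a+b] a b = cong (λ x → suc (x + b)) (+-suc a a)

n≡⌊n/2⌋+⌊n/2⌋+bit[parity[n]] : ∀ p → p ≡ ⌊ p /2⌋ + ⌊ p /2⌋ + bit (parity p)
n≡⌊n/2⌋+⌊n/2⌋+bit[parity[n]] 0 = refl
n≡⌊n/2⌋+⌊n/2⌋+bit[parity[n]] 1 = refl
n≡⌊n/2⌋+⌊n/2⌋+bit[parity[n]] (suc (suc p)) =
  trans (cong (suc ∘ suc) (n≡⌊n/2⌋+⌊n/2⌋+bit[parity[n]] p))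
        (≡.sym ([1+a]+[1+a]+b≡2+[a+a+b] ⌊ p /2⌋ (bit (parity p))))

⌊[a+a+bit]/2⌋≡a : ∀ a π → ⌊ a + a + bit π /2⌋ ≡ a
⌊[a+a+bit]/2⌋≡a zero 0ℙ = refl
⌊[a+a+bit]/2⌋≡a zero 1ℙ = refl
⌊[a+a+bit]/2⌋≡a (suc a) π rewrite [1+a]+[1+a]+b≡2+[a+a+b] a (bit π) = cong suc (⌊[a+a+bit]/2⌋≡a a π)

parity[a+a+bit]≡ : ∀ a π → parity (a + a + bit π) ≡ π
parity[a+a+bit]≡ zero 0ℙ = refl
parity[a+a+bit]≡ zero 1ℙ = refl
parity[a+a+bit]≡ (suc a) π rewrite [1+a]+[1+a]+b≡2+[a+a+b] a (bit π) = parity[a+a+bit]≡ a π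

r<m⇒r+r+bit<m+m : ∀ {r m} π → r < m → r + r + bit π < m + m
r<m⇒r+r+bit<m+m {r} {m} π r<m = begin-strict
  r + r + bit π ≤⟨ +-monoʳ-≤ (r + r) (bit≤1 π) ⟩
  r + r + 1     ≡⟨ +-comm (r + r) 1 ⟩
  suc (r + r)   <⟨ +-mono-≤-< r<m r<m ⟩
  m + m         ∎
  where open ≤-Reasoning

[a+a+bit]%[m+m]≡ : ∀ {n m} .{{_ : NonZero n}} .{{_ : NonZero m}} → n ≡ m + m → ∀ a π →
  (a + a + bit π) % n ≡ a % m + a % m + bit π
[a+a+bit]%[m+m]≡ {m = m} refl a π = begin
  (a + a + bit π) % (m + m)                   ≡⟨ cong (λ x → (x + x + bit π) % (m + m)) (m≡m%n+[m/n]*n a m) ⟩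
  (r + q * m + (r + q * m) + bit π) % (m + m) ≡⟨ cong (_% (m + m)) (regroup r q m (bit π)) ⟩
  (r + r + bit π + q * (m + m)) % (m + m)     ≡⟨ [m+kn]%n≡m%n (r + r + bit π) q (m + m) ⟩
  (r + r + bit π) % (m + m)                   ≡⟨ m<n⇒m%n≡m (r<m⇒r+r+bit<m+m π (m%n<n a m)) ⟩
  r + r + bit π                               ∎
  where
  open ≡.≡-Reasoning
  r = a % m
  q = a / m
  regroup : ∀ r q m b → r + q * m + (r + q * m) + b ≡ r + r + b + q * (m + m)
  regroup = solve-∀

[m%n+o]%n≡[m+o]%n : ∀ m o n .{{_ : NonZero n}} → (m % n + o) % n ≡ (m + o) % n
[m%n+o]%n≡[m+o]%n m o n = begin
  (m % n + o) % n           ≡⟨ %-distribˡ-+ (m % n) o n ⟩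
  (m % n % n + o % n) % n   ≡⟨ cong (λ x → (x + o % n) % n) (m%n%n≡m%n m n) ⟩
  (m % n + o % n) % n       ≡⟨ %-distribˡ-+ m o n ⟨
  (m + o) % n               ∎
  where open ≡.≡-Reasoning

[m%n*o]%n≡[m*o]%n : ∀ m o n .{{_ : NonZero n}} → (m % n * o) % n ≡ (m * o) % n
[m%n*o]%n≡[m*o]%n m o n = begin
  (m % n * o) % n           ≡⟨ %-distribˡ-* (m % n) o n ⟩
  (m % n % n * (o % n)) % n ≡⟨ cong (λ x → (x * (o % n)) % n) (m%n%n≡m%n m n) ⟩
  (m % n * (o % n)) % n     ≡⟨ %-distribˡ-* m o n ⟨
  (m * o) % n               ∎
  where open ≡.≡-Reasoning

-- Adding e = n ∸ d % n undoes adding d.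
[a+d]%n≡[b+d]%n⇒a≡b : ∀ {a b} d n .{{_ : NonZero n}} → a < n → b < n → (a + d) % n ≡ (b + d) % n → a ≡ b
[a+d]%n≡[b+d]%n⇒a≡b {a} {b} d n a<n b<n eq = begin
  a                         ≡⟨ undo a<n ⟨
  ((a + d) % n + e) % n     ≡⟨ cong (λ x → (x + e) % n) eq ⟩
  ((b + d) % n + e) % n     ≡⟨ undo b<n ⟩
  b                         ∎
  where
  open ≡.≡-Reasoning
  e = n ∸ d % n
  [d+e]%n≡0 : (d + e) % n ≡ 0
  [d+e]%n≡0 = begin
    (d + e) % n       ≡⟨ [m%n+o]%n≡[m+o]%n d e n ⟨
    (d % n + e) % n   ≡⟨ cong (_% n) (m+[n∸m]≡n (<⇒≤ (m%n<n d n))) ⟩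
    n % n             ≡⟨ n%n≡0 n ⟩
    0                 ∎
  undo : ∀ {x} → x < n → ((x + d) % n + e) % n ≡ x
  undo {x} x<n = begin
    ((x + d) % n + e) % n     ≡⟨ [m%n+o]%n≡[m+o]%n (x + d) e n ⟩
    (x + d + e) % n           ≡⟨ cong (_% n) (+-assoc x d e) ⟩
    (x + (d + e)) % n         ≡⟨ %-distribˡ-+ x (d + e) n ⟩
    (x % n + (d + e) % n) % n ≡⟨ cong (λ y → (x % n + y) % n) [d+e]%n≡0 ⟩
    (x % n + 0) % n           ≡⟨ cong (_% n) (+-identityʳ (x % n)) ⟩
    x % n % n                 ≡⟨ m%n%n≡m%n x n ⟩
    x % n                     ≡⟨ m<n⇒m%n≡m x<n ⟩
    x                         ∎

[x+d+d]%n≡[x+[d+d]]%n : ∀ {x y} d n .{{_ : NonZero n}} → y ≡ (x + d) % n → (y + d) % n ≡ (x + (d + d)) % n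
[x+d+d]%n≡[x+[d+d]]%n {x} d n refl = trans ([m%n+o]%n≡[m+o]%n (x + d) d n) (cong (_% n) (+-assoc x d d))

step-both-ways⇒n≡d+d : ∀ {x y} d n .{{_ : NonZero n}} → x < n → 1 ≤ d → d + d ≤ n →
  y ≡ (x + d) % n → x ≡ (y + d) % n → n ≡ d + d
step-both-ways⇒n≡d+d {x} d n x<n 1≤d d+d≤n y≡ x≡ with n ≤? x + (d + d)
... | yes n≤x+2d = +-cancelˡ-≡ x n (d + d) (begin
  x + n                       ≡⟨ +-comm x n ⟩
  n + x                       ≡⟨ cong (n +_) x≡x+2d∸n ⟩
  n + (x + (d + d) ∸ n)       ≡⟨ m+[n∸m]≡n n≤x+2d ⟩
  x + (d + d)                 ∎)
  where
  open ≡.≡-Reasoning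
  x≡x+2d∸n : x ≡ x + (d + d) ∸ n
  x≡x+2d∸n = begin
    x                         ≡⟨ trans x≡ ([x+d+d]%n≡[x+[d+d]]%n d n y≡) ⟩
    (x + (d + d)) % n         ≡⟨ m≤n⇒[n∸m]%m≡n%m n≤x+2d ⟨
    (x + (d + d) ∸ n) % n     ≡⟨ m<n⇒m%n≡m (m<n+o⇒m∸n<o (x + (d + d)) n (+-mono-<-≤ x<n d+d≤n)) ⟩
    x + (d + d) ∸ n           ∎
... | no n≰x+2d = ⊥-elim (m+1+n≢m x (≡.sym (begin
  x                           ≡⟨ trans x≡ ([x+d+d]%n≡[x+[d+d]]%n d n y≡) ⟩
  (x + (d + d)) % n           ≡⟨ m<n⇒m%n≡m (≰⇒> n≰x+2d) ⟩
  x + (d + d)                 ≡⟨ cong (λ e → x + (e + d)) (m+[n∸m]≡n 1≤d) ⟨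
  x + suc (d ∸ 1 + d)         ∎)))
  where open ≡.≡-Reasoning

n≡d+d⇒step-back : ∀ {x y} d n .{{_ : NonZero n}} → n ≡ d + d → x < n → y ≡ (x + d) % n → x ≡ (y + d) % n
n≡d+d⇒step-back {x} d n n≡d+d x<n y≡ = ≡.sym (begin
  (_ + d) % n               ≡⟨ [x+d+d]%n≡[x+[d+d]]%n d n y≡ ⟩
  (x + (d + d)) % n         ≡⟨ cong (λ e → (x + e) % n) n≡d+d ⟨
  (x + n) % n               ≡⟨ [m+n]%n≡m%n x n ⟩
  x % n                     ≡⟨ m<n⇒m%n≡m x<n ⟩
  x                         ∎)
  where open ≡.≡-Reasoning

m≤a<m+m⇒a%m+m≡a : ∀ {a m} .{{_ : NonZero m}} → m ≤ a → a < m + m → a % m + m ≡ a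
m≤a<m+m⇒a%m+m≡a {a} {m} m≤a a<m+m = begin
  a % m + m           ≡⟨ cong (_+ m) (m≤n⇒[n∸m]%m≡n%m m≤a) ⟨
  (a ∸ m) % m + m     ≡⟨ cong (_+ m) (m<n⇒m%n≡m (m<n+o⇒m∸n<o a m a<m+m)) ⟩
  a ∸ m + m           ≡⟨ m∸n+n≡m m≤a ⟩
  a                   ∎
  where open ≡.≡-Reasoning

module Positions {n m : ℕ} .{{_ : NonZero n}} .{{_ : NonZero m}} (n≡m+m : n ≡ m + m) (t : ℕ) where

  position : ℕ → ℕ
  position p = (⌊ p /2⌋ * t) % m

  parity-position-after : ∀ p d {q} a π → p + d ≡ a + a + bit π → q ≡ (p + d) % n →
    parity q ≡ π × position q ≡ (a * t) % m
  parity-position-after p d {q} a π p+d≡ q≡ = parity-q , position-q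
    where
    q≡2[a%m]+bit : q ≡ a % m + a % m + bit π
    q≡2[a%m]+bit = trans q≡ (trans (cong (_% n) p+d≡) ([a+a+bit]%[m+m]≡ n≡m+m a π))
    parity-q : parity q ≡ π
    parity-q = trans (cong parity q≡2[a%m]+bit) (parity[a+a+bit]≡ (a % m) π)
    position-q : position q ≡ (a * t) % m
    position-q = begin
      (⌊ q /2⌋ * t) % m                          ≡⟨ cong (λ x → (⌊ x /2⌋ * t) % m) q≡2[a%m]+bit ⟩
      (⌊ a % m + a % m + bit π /2⌋ * t) % m      ≡⟨ cong (λ x → (x * t) % m) (⌊[a+a+bit]/2⌋≡a (a % m) π) ⟩
      (a % m * t) % m                            ≡⟨ [m%n*o]%n≡[m*o]%n a t m ⟩
      (a * t) % m                                ∎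
      where open ≡.≡-Reasoning

  private
    halves : ∀ p {π} → parity p ≡ π → p ≡ ⌊ p /2⌋ + ⌊ p /2⌋ + bit π
    halves p refl = n≡⌊n/2⌋+⌊n/2⌋+bit[parity[n]] p

  outer-step-from-even : ∀ {p q} → parity p ≡ 0ℙ → q ≡ (p + 1) % n → parity q ≡ 1ℙ × position q ≡ position p
  outer-step-from-even {p} even q≡ =
    parity-position-after p 1 ⌊ p /2⌋ 1ℙ (cong (_+ 1) (trans (halves p even) (+-identityʳ _))) q≡

  outer-step-from-odd : ∀ {p q} → parity p ≡ 1ℙ → q ≡ (p + 1) % n → parity q ≡ 0ℙ × position q ≡ (position p + t) % m
  outer-step-from-odd {p} {q} odd q≡
    with parity-position-after p 1 (suc ⌊ p /2⌋) 0ℙ (trans (cong (_+ 1) (halves p odd)) (regroup ⌊ p /2⌋)) q≡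
    where
    regroup : ∀ a → a + a + 1 + 1 ≡ suc a + suc a + 0
    regroup = solve-∀
  ... | parity-q , position-q = parity-q , (begin
    position q                    ≡⟨ position-q ⟩
    (t + ⌊ p /2⌋ * t) % m         ≡⟨ cong (_% m) (+-comm t (⌊ p /2⌋ * t)) ⟩
    (⌊ p /2⌋ * t + t) % m         ≡⟨ [m%n+o]%n≡[m+o]%n (⌊ p /2⌋ * t) t m ⟨
    (position p + t) % m          ∎)
    where open ≡.≡-Reasoning

  inner-step : ∀ {h k} → k ≡ h + h → (h * t) % m ≡ 1 → ∀ {p q} → q ≡ (p + k) % n →
    parity q ≡ parity p × position q ≡ (position p + 1) % m
  inner-step {h} {k} k≡h+h ht≡1 {p} {q} q≡
    with parity-position-after p k (⌊ p /2⌋ + h) (parity p)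
           (trans (cong₂ _+_ (n≡⌊n/2⌋+⌊n/2⌋+bit[parity[n]] p) k≡h+h) (regroup ⌊ p /2⌋ h (bit (parity p)))) q≡
    where
    regroup : ∀ a h b → a + a + b + (h + h) ≡ a + h + (a + h) + b
    regroup = solve-∀
  ... | parity-q , position-q = parity-q , (begin
    position q                            ≡⟨ position-q ⟩
    ((⌊ p /2⌋ + h) * t) % m               ≡⟨ cong (_% m) (*-distribʳ-+ t ⌊ p /2⌋ h) ⟩
    (⌊ p /2⌋ * t + h * t) % m             ≡⟨ %-distribˡ-+ (⌊ p /2⌋ * t) (h * t) m ⟩
    (position p + (h * t) % m) % m        ≡⟨ cong (λ x → (position p + x) % m) ht≡1 ⟩
    (position p + 1) % m                  ∎)
    where open ≡.≡-Reasoning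

-- Labels of positions

T-∧-intro : ∀ {a b} → T a → T b → T (a ∧ b)
T-∧-intro p q = Equivalence.from T-∧ (p , q)

T-not : ∀ {a} → ¬ T a → T (not a)
T-not {false} _  = tt
T-not {true}  ¬a = ¬a tt

T-⇒ᵇ : ∀ {a b} → (T a → T b) → T (a ⇒ᵇ b)
T-⇒ᵇ {false} _ = tt
T-⇒ᵇ {true}  f = Equivalence.from T-∨ (inj₂ (f tt))

residueLabel : ℕ → Label
residueLabel 0 = R0
residueLabel 1 = R1
residueLabel 2 = R2
residueLabel (suc (suc (suc j))) = residueLabel j

residueLabel-elim : (P : Label → Set) → P R0 → P R1 → P R2 → ∀ j → P (residueLabel j)
residueLabel-elim P p₀ p₁ p₂ 0 = p₀
residueLabel-elim P p₀ p₁ p₂ 1 = p₁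
residueLabel-elim P p₀ p₁ p₂ 2 = p₂
residueLabel-elim P p₀ p₁ p₂ (suc (suc (suc j))) = residueLabel-elim P p₀ p₁ p₂ j

label : ℕ → ℕ → Label
label m zero = F0
label m (suc j) with suc (suc j) ≟ m | suc (suc (suc j)) ≟ m
... | yes _ | _     = E1
... | no _  | yes _ = E2
... | no _  | no _  = residueLabel (suc j)

data LabelView (m j : ℕ) : Label → Set where
  first  : j ≡ 0 → LabelView m j F0
  last   : j ≢ 0 → suc j ≡ m → LabelView m j E1
  penult : j ≢ 0 → suc j ≢ m → suc (suc j) ≡ m → LabelView m j E2
  middle : j ≢ 0 → suc j ≢ m → suc (suc j) ≢ m → LabelView m j (residueLabel j)

labelView : ∀ m j → LabelView m j (label m j)
labelView m zero = first refl
labelView m (suc j) with suc (suc j) ≟ m | suc (suc (suc j)) ≟ m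
... | yes last?    | _            = last (λ ()) last?
... | no ¬last     | yes penult?  = penult (λ ()) ¬last penult?
... | no ¬last     | no ¬penult   = middle (λ ()) ¬last ¬penult

residue-residueLabel : ∀ μ j → residue μ (residueLabel j) ≡ j % 3
residue-residueLabel μ 0 = refl
residue-residueLabel μ 1 = refl
residue-residueLabel μ 2 = refl
residue-residueLabel μ (suc (suc (suc j))) = residue-residueLabel μ j

[[d+j]%3+e]%3≡j%3 : ∀ d e j → d + e ≡ 3 → ((d + j) % 3 + e) % 3 ≡ j % 3
[[d+j]%3+e]%3≡j%3 d e j d+e≡3 = begin
  ((d + j) % 3 + e) % 3   ≡⟨ [m%n+o]%n≡[m+o]%n (d + j) e 3 ⟩
  (d + j + e) % 3         ≡⟨ cong (_% 3) (regroup d j e) ⟩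
  (j + (d + e)) % 3       ≡⟨ cong (λ x → (j + x) % 3) d+e≡3 ⟩
  (j + 3) % 3             ≡⟨ [m+n]%n≡m%n j 3 ⟩
  j % 3                   ∎
  where
  open ≡.≡-Reasoning
  regroup : ∀ d j e → d + j + e ≡ j + (d + e)
  regroup = solve-∀

residue-label : ∀ m j → residue (m % 3) (label m j) ≡ j % 3
residue-label m j with label m j | labelView m j
... | _ | first refl         = refl
... | _ | last _ refl        = [[d+j]%3+e]%3≡j%3 1 2 j refl
... | _ | penult _ _ refl    = [[d+j]%3+e]%3≡j%3 2 1 j refl
... | _ | middle _ _ _       = residue-residueLabel (m % 3) j

label-F0 : ∀ m j → T (isF0 (label m j)) → j ≡ 0
label-F0 m j labelled with label m j | labelView m j
... | _ | first j≡0          = j≡0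
... | _ | middle _ _ _       = ⊥-elim (residueLabel-elim (λ l → ¬ T (isF0 l)) (λ ()) (λ ()) (λ ()) j labelled)

label-E1 : ∀ m j → T (isE1 (label m j)) → suc j ≡ m
label-E1 m j labelled with label m j | labelView m j
... | _ | last _ last?       = last?
... | _ | middle _ _ _       = ⊥-elim (residueLabel-elim (λ l → ¬ T (isE1 l)) (λ ()) (λ ()) (λ ()) j labelled)

label-E2 : ∀ m j → T (isE2 (label m j)) → suc (suc j) ≡ m
label-E2 m j labelled with label m j | labelView m j
... | _ | penult _ _ penult? = penult?
... | _ | middle _ _ _       = ⊥-elim (residueLabel-elim (λ l → ¬ T (isE2 l)) (λ ()) (λ ()) (λ ()) j labelled)

label-last : ∀ m j → 2 ≤ m → suc j ≡ m → label m j ≡ E1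
label-last m j 2≤m last? with label m j | labelView m j
... | _ | first refl                = ⊥-elim (<-irrefl last? 2≤m)
... | _ | last _ _                  = refl
... | _ | penult _ ¬last _          = contradiction last? ¬last
... | _ | middle _ ¬last _          = contradiction last? ¬last

label-penult : ∀ m j → j ≢ 0 → suc (suc j) ≡ m → label m j ≡ E2
label-penult m j j≢0 penult? with label m j | labelView m j
... | _ | first j≡0                 = contradiction j≡0 j≢0
... | _ | last _ last?              = contradiction (trans penult? (≡.sym last?)) 1+n≢n
... | _ | penult _ _ _              = refl
... | _ | middle _ _ ¬penult        = contradiction penult? ¬penult

label-middle : ∀ m j → j ≢ 0 → suc j ≢ m → suc (suc j) ≢ m → label m j ≡ residueLabel j
label-middle m j j≢0 ¬last ¬penult with label m j | labelView m j
... | _ | first j≡0                 = contradiction j≡0 j≢0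
... | _ | last _ last?              = contradiction last? ¬last
... | _ | penult _ _ penult?        = contradiction penult? ¬penult
... | _ | middle _ _ _              = refl

[j+t]%3≡residue+t%3 : ∀ m j t → (j + t) % 3 ≡ (residue (m % 3) (label m j) + t % 3) % 3
[j+t]%3≡residue+t%3 m j t = trans (%-distribˡ-+ j t 3) (cong (λ x → (x + t % 3) % 3) (≡.sym (residue-label m j)))

outerStepWithin-label : ∀ {m j t} → 1 ≤ t → j + t < m →
  T (outerStepWithin (m % 3) (t % 3) (label m j) (label m (j + t)))
outerStepWithin-label {m} {j} {t} 1≤t j+t<m =
  T-∧-intro (≡⇒≡ᵇ _ _ (trans (residue-label m (j + t)) ([j+t]%3≡residue+t%3 m j t)))
  (T-∧-intro (T-not target≢F0) (T-∧-intro (T-not source≢E1) (T-⇒ᵇ source-penult⇒target-last)))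
  where
  1+j≤j+t : suc j ≤ j + t
  1+j≤j+t = subst (_≤ j + t) (+-comm j 1) (+-monoʳ-≤ j 1≤t)
  target≢F0 : ¬ T (isF0 (label m (j + t)))
  target≢F0 = (λ j+t≡0 → <-irrefl (≡.sym j+t≡0) (≤-trans 1≤t (m≤n+m t j))) ∘ label-F0 m (j + t)
  source≢E1 : ¬ T (isE1 (label m j))
  source≢E1 = (λ 1+j≡m → <-irrefl 1+j≡m (≤-<-trans 1+j≤j+t j+t<m)) ∘ label-E1 m j
  source-penult⇒target-last : T (isE2 (label m j)) → T (isE1 (label m (j + t)))
  source-penult⇒target-last labelled = subst (T ∘ isE1) (≡.sym (label-last m (j + t) 2≤m 1+j+t≡m)) tt
    where
    2+j≡m = label-E2 m j labelled
    t≡1 : t ≡ 1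
    t≡1 = ≤-antisym (s≤s⁻¹ (+-cancelˡ-< j t 2 (subst (j + t <_) (trans (≡.sym 2+j≡m) (+-comm 2 j)) j+t<m))) 1≤t
    2≤m : 2 ≤ m
    2≤m = subst (2 ≤_) 2+j≡m (s≤s (s≤s z≤n))
    1+j+t≡m : suc (j + t) ≡ m
    1+j+t≡m = trans (cong (λ x → suc (j + x)) t≡1) (trans (cong suc (+-comm j 1)) 2+j≡m)

outerStepWrapping-label : ∀ {m j t j′} → 2 ≤ m → j < m → t < m → j′ + m ≡ j + t →
  T (outerStepWrapping (m % 3) (t % 3) (label m j) (label m j′))
outerStepWrapping-label {m} {j} {t} {j′} 2≤m j<m t<m j′+m≡j+t =
  T-∧-intro (≡⇒≡ᵇ _ _ residues)
  (T-∧-intro (T-not source≢F0) (T-∧-intro (T-not target≢E1) (T-⇒ᵇ target-penult⇒source-last)))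
  where
  3+j+t≤m+m : suc (suc (j + t)) ≤ m + m
  3+j+t≤m+m = subst (_≤ m + m) (cong suc (+-suc j t)) (+-mono-≤ j<m t<m)
  residues : (residue (m % 3) (label m j′) + m % 3) % 3 ≡ (residue (m % 3) (label m j) + t % 3) % 3
  residues = begin
    (residue (m % 3) (label m j′) + m % 3) % 3  ≡⟨ cong (λ x → (x + m % 3) % 3) (residue-label m j′) ⟩
    (j′ % 3 + m % 3) % 3                        ≡⟨ %-distribˡ-+ j′ m 3 ⟨
    (j′ + m) % 3                                ≡⟨ cong (_% 3) j′+m≡j+t ⟩
    (j + t) % 3                                 ≡⟨ [j+t]%3≡residue+t%3 m j t ⟩
    (residue (m % 3) (label m j) + t % 3) % 3   ∎
    where open ≡.≡-Reasoning
  source≢F0 : ¬ T (isF0 (label m j))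
  source≢F0 = (λ j≡0 → <-irrefl refl (<-≤-trans t<m (subst (m ≤_) (trans j′+m≡j+t (cong (_+ t) j≡0)) (m≤n+m m j′))))
              ∘ label-F0 m j
  target≢E1 : ¬ T (isE1 (label m j′))
  target≢E1 = (λ 1+j′≡m → <-irrefl refl (≤-trans 3+j+t≤m+m (≤-reflexive (begin
    m + m                 ≡⟨ cong (_+ m) 1+j′≡m ⟨
    suc (j′ + m)          ≡⟨ cong suc j′+m≡j+t ⟩
    suc (j + t)           ∎)))) ∘ label-E1 m j′
    where open ≡.≡-Reasoning
  target-penult⇒source-last : T (isE2 (label m j′)) → T (isE1 (label m j))
  target-penult⇒source-last labelled = subst (T ∘ isE1) (≡.sym (label-last m j 2≤m 1+j≡m)) tt
    where
    m+m≡2+j+t : m + m ≡ suc (suc (j + t))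
    m+m≡2+j+t = trans (cong (_+ m) (≡.sym (label-E2 m j′ labelled))) (cong (suc ∘ suc) j′+m≡j+t)
    1+j≡m : suc j ≡ m
    1+j≡m with m≤n⇒m<n∨m≡n j<m
    ... | inj₂ 1+j≡m = 1+j≡m
    ... | inj₁ 2+j≤m = ⊥-elim (<-irrefl (≡.sym m+m≡2+j+t)
                                (subst (_≤ m + m) (cong (suc ∘ suc) (+-suc j t)) (+-mono-≤ 2+j≤m t<m)))

outerStep-label : ∀ {m t} .{{_ : NonZero m}} → 2 ≤ m → 1 ≤ t → t < m → ∀ {j} → j < m →
  T (outerStep (m % 3) (t % 3) (label m j) (label m ((j + t) % m)))
outerStep-label {m} {t} 2≤m 1≤t t<m {j} j<m with j + t <? m
... | yes j+t<m rewrite m<n⇒m%n≡m j+t<m =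
  Equivalence.from T-∨ (inj₁ (outerStepWithin-label 1≤t j+t<m))
... | no j+t≮m =
  Equivalence.from T-∨ (inj₂ (outerStepWrapping-label 2≤m j<m t<m
    (m≤a<m+m⇒a%m+m≡a (≮⇒≥ j+t≮m) (+-mono-< j<m t<m))))

residueLabel-consecutive : ∀ μ j → T (innerStep μ (residueLabel j) (residueLabel (suc j)))
residueLabel-consecutive μ 0 = tt
residueLabel-consecutive μ 1 = tt
residueLabel-consecutive μ 2 = tt
residueLabel-consecutive μ (suc (suc (suc j))) = residueLabel-consecutive μ j

residueLabel-E2 : ∀ j → T (innerStep (j % 3) (residueLabel j) E2)
residueLabel-E2 0 = tt
residueLabel-E2 1 = tt
residueLabel-E2 2 = tt
residueLabel-E2 (suc (suc (suc j))) = residueLabel-E2 j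

innerStep-consecutive : ∀ {m} → 3 ≤ m → ∀ j → suc j < m → T (innerStep (m % 3) (label m j) (label m (suc j)))
innerStep-consecutive {m} 3≤m zero _ with label m 1 | labelView m 1
... | _ | last _ 2≡m          = ⊥-elim (<-irrefl 2≡m 3≤m)
... | _ | penult _ _ refl     = tt
... | _ | middle _ _ _        = tt
innerStep-consecutive {m} 3≤m (suc j) 2+j<m with label m (suc (suc j)) | labelView m (suc (suc j))
... | _ | last _ 3+j≡m
  rewrite label-penult m (suc j) (λ ()) 3+j≡m = tt
... | _ | penult _ ¬last refl
  rewrite label-middle m (suc j) (λ ()) (<⇒≢ 2+j<m) ¬last = residueLabel-E2 (suc j)
... | _ | middle _ ¬last _
  rewrite label-middle m (suc j) (λ ()) (<⇒≢ 2+j<m) ¬last = residueLabel-consecutive (m % 3) (suc j)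

innerStep-label : ∀ {m} .{{_ : NonZero m}} → 3 ≤ m → ∀ {j} → j < m →
  T (innerStep (m % 3) (label m j) (label m ((j + 1) % m)))
innerStep-label {m} 3≤m {j} j<m with m≤n⇒m<n∨m≡n j<m
... | inj₁ 1+j<m rewrite +-comm j 1 | m<n⇒m%n≡m 1+j<m = innerStep-consecutive 3≤m j 1+j<m
... | inj₂ 1+j≡m rewrite label-last m j (≤-trans (n≤1+n 2) 3≤m) 1+j≡m
                     | trans (cong (_% m) (trans (+-comm j 1) 1+j≡m)) (n%n≡0 m) = tt

swapsF0E1-label : ∀ {m t} .{{_ : NonZero m}} → m ≡ 2 → t ≡ 1 → ∀ {j} → j < m →
  T (swapsF0E1 (label m j) (label m ((j + t) % m)))
swapsF0E1-label refl refl {0} _ = tt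
swapsF0E1-label refl refl {1} _ = tt
swapsF0E1-label refl refl {suc (suc _)} (s≤s (s≤s ()))

-- GP(n,k) maps onto the pattern

module Ports (n k : ℕ) .{{_ : NonZero n}} where

  direction : ℕ → ℕ → ℕ → Port
  direction d p q = if does (q ≟ (p + d) % n) then forward else backward

  port : Vertex n → Vertex n → Port
  port (u p) (u q) = direction 1 (toℕ p) (toℕ q)
  port (v p) (v q) = direction k (toℕ p) (toℕ q)
  port (u _) (v _) = spoke
  port (v _) (u _) = spoke

  direction-forward : ∀ d p {q} → q ≡ (p + d) % n → direction d p q ≡ forward
  direction-forward d p {q} q≡ = cong (if_then forward else backward) (dec-true (q ≟ (p + d) % n) q≡)

  direction-backward : ∀ d p {q} → q ≢ (p + d) % n → direction d p q ≡ backward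
  direction-backward d p {q} q≢ = cong (if_then forward else backward) (dec-false (q ≟ (p + d) % n) q≢)

  direction≢spoke : ∀ d p q → direction d p q ≢ spoke
  direction≢spoke d p q with q ≟ (p + d) % n
  ... | yes q≡ = λ eq → contradiction (trans (≡.sym (direction-forward d p q≡)) eq) λ ()
  ... | no q≢  = λ eq → contradiction (trans (≡.sym (direction-backward d p q≢)) eq) λ ()

  direction-injective : ∀ d {p q q′} → q < n → q′ < n →
    q ≡ (p + d) % n ⊎ p ≡ (q + d) % n → q′ ≡ (p + d) % n ⊎ p ≡ (q′ + d) % n →
    direction d p q ≡ direction d p q′ → q ≡ q′
  direction-injective d {p} {q} {q′} q<n q′<n q~p q′~p same-direction
    with q ≟ (p + d) % n | q′ ≟ (p + d) % n
  ... | yes q≡ | yes q′≡ = trans q≡ (≡.sym q′≡)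
  ... | yes q≡ | no q′≢  = contradiction
    (trans (≡.sym (direction-forward d p q≡)) (trans same-direction (direction-backward d p q′≢))) λ ()
  ... | no q≢  | yes q′≡ = contradiction
    (trans (≡.sym (direction-backward d p q≢)) (trans same-direction (direction-forward d p q′≡))) λ ()
  ... | no q≢  | no q′≢  =
    [a+d]%n≡[b+d]%n⇒a≡b d n q<n q′<n (trans (≡.sym (backwards q~p q≢)) (backwards q′~p q′≢))
    where
    backwards : ∀ {r} → r ≡ (p + d) % n ⊎ p ≡ (r + d) % n → r ≢ (p + d) % n → p ≡ (r + d) % n
    backwards (inj₁ r≡) r≢ = contradiction r≡ r≢
    backwards (inj₂ p≡) _  = p≡

  Adj-sym : ∀ {x y} → Adj n k x y → Adj n k y x
  Adj-sym {u _} {u _} (inj₁ a) = inj₂ a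
  Adj-sym {u _} {u _} (inj₂ a) = inj₁ a
  Adj-sym {v _} {v _} (inj₁ a) = inj₂ a
  Adj-sym {v _} {v _} (inj₂ a) = inj₁ a
  Adj-sym {u _} {v _} a = ≡.sym a
  Adj-sym {v _} {u _} a = ≡.sym a

  port-injective : ∀ {x y z} → Adj n k x y → Adj n k x z → port x y ≡ port x z → y ≡ z
  port-injective {u p} {u q} {u q′} a a′ eq = cong u (toℕ-injective (direction-injective 1 (toℕ<n q) (toℕ<n q′) a a′ eq))
  port-injective {v p} {v q} {v q′} a a′ eq = cong v (toℕ-injective (direction-injective k (toℕ<n q) (toℕ<n q′) a a′ eq))
  port-injective {u p} {u q} {v _}  _ _ eq = contradiction eq (direction≢spoke 1 (toℕ p) (toℕ q))
  port-injective {v p} {v q} {u _}  _ _ eq = contradiction eq (direction≢spoke k (toℕ p) (toℕ q))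
  port-injective {u p} {v _} {u q}  _ _ eq = contradiction (≡.sym eq) (direction≢spoke 1 (toℕ p) (toℕ q))
  port-injective {v p} {u _} {v q}  _ _ eq = contradiction (≡.sym eq) (direction≢spoke k (toℕ p) (toℕ q))
  port-injective {u _} {v _} {v _}  a a′ _ = cong v (trans (≡.sym a) a′)
  port-injective {v _} {u _} {u _}  a a′ _ = cong u (trans (≡.sym a) a′)

module Covering {n k m t h : ℕ} .{{_ : NonZero n}} .{{_ : NonZero m}} (n≡m+m : n ≡ m + m) (4≤n : 4 ≤ n)
  (k≡h+h : k ≡ h + h) (ht≡1 : (h * t) % m ≡ 1) (1≤k : 1 ≤ k) (k+k≤n : k + k ≤ n) (c : Case)
  (outer-fits : ∀ {j} → j < m → T (outerLink c (label m j) (label m ((j + t) % m))))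
  (inner-fits : n ≢ k + k → ∀ {j} → j < m → T (innerLink c (label m j) (label m ((j + 1) % m))))
  (doubled-fits : n ≡ k + k → ∀ {j} → j < m → T (degenerateLink c (label m j) (label m ((j + 1) % m)))) where

  open Positions n≡m+m t
  open Ports n k

  position<m : ∀ p → position p < m
  position<m p = m%n<n (⌊ p /2⌋ * t) m

  nodeAt : Vertex n → Node
  nodeAt (u p) = node outer (parity (toℕ p)) (label m (position (toℕ p)))
  nodeAt (v p) = node inner (parity (toℕ p)) (label m (position (toℕ p)))

  dart : Vertex n → Vertex n → Dart
  dart x y = nodeAt x , port x y

  outer-forward-link : ∀ {p q} → q ≡ (p + 1) % n →
    (node outer (parity q) (label m (position q)) , backward) ∈ links c (node outer (parity p) (label m (position p)) , forward)
  outer-forward-link {p} {q} q≡ with parity p in parity-p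
  ... | 0ℙ with outer-step-from-even parity-p q≡
  ...   | parity-q , position-q rewrite parity-q | position-q = here refl
  outer-forward-link {p} {q} q≡ | 1ℙ with outer-step-from-odd parity-p q≡
  ...   | parity-q , position-q rewrite parity-q | position-q = ∈-dartsWhere (outerLink c _) (outer-fits (position<m p))

  outer-backward-link : ∀ {p q} → p ≡ (q + 1) % n →
    (node outer (parity q) (label m (position q)) , forward) ∈ links c (node outer (parity p) (label m (position p)) , backward)
  outer-backward-link {p} {q} p≡ with parity q in parity-q
  ... | 0ℙ with outer-step-from-even parity-q p≡
  ...   | parity-p , position-p rewrite parity-p | position-p = here refl
  outer-backward-link {p} {q} p≡ | 1ℙ with outer-step-from-odd parity-q p≡
  ...   | parity-p , position-p rewrite parity-p | position-p = ∈-dartsWhere (λ l → outerLink c l _) (outer-fits (position<m q))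

  inner-forward-link : ∀ {p q} → n ≢ k + k → q ≡ (p + k) % n →
    (node inner (parity q) (label m (position q)) , backward) ∈ links c (node inner (parity p) (label m (position p)) , forward)
  inner-forward-link {p} {q} n≢k+k q≡ with inner-step {h} k≡h+h ht≡1 q≡
  ... | parity-q , position-q rewrite parity-q | position-q =
    ∈-++⁺ˡ (∈-dartsWhere (innerLink c _) (inner-fits n≢k+k (position<m p)))

  inner-backward-link : ∀ {p q} → n ≢ k + k → p ≡ (q + k) % n →
    (node inner (parity q) (label m (position q)) , forward) ∈ links c (node inner (parity p) (label m (position p)) , backward)
  inner-backward-link {p} {q} n≢k+k p≡ with inner-step {h} k≡h+h ht≡1 p≡
  ... | parity-p , position-p rewrite parity-p | position-p =
    ∈-dartsWhere (λ l → innerLink c l _) (inner-fits n≢k+k (position<m q))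

  inner-doubled-link : ∀ {p q} → n ≡ k + k → q ≡ (p + k) % n →
    (node inner (parity q) (label m (position q)) , forward) ∈ links c (node inner (parity p) (label m (position p)) , forward)
  inner-doubled-link {p} {q} n≡k+k q≡ with inner-step {h} k≡h+h ht≡1 q≡
  ... | parity-q , position-q rewrite parity-q | position-q =
    ∈-++⁺ʳ _ (∈-dartsWhere (degenerateLink c _) (doubled-fits n≡k+k (position<m p)))

  link : ∀ {x y} → Adj n k x y → dart y x ∈ links c (dart x y)
  link {u p} {v q} refl = here refl
  link {v p} {u q} refl = here refl
  link {u p} {u q} p~q with toℕ q ≟ (toℕ p + 1) % n | toℕ p ≟ (toℕ q + 1) % n
  ... | yes q≡ | yes p≡ = contradiction (step-both-ways⇒n≡d+d 1 n (toℕ<n p) ≤-refl (≤-trans (s≤s (s≤s z≤n)) 4≤n) q≡ p≡)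
                            λ n≡2 → <-irrefl (≡.sym n≡2) (≤-trans (n≤1+n 3) 4≤n)
  ... | yes q≡ | no p≢  = subst₂ (λ P Q → (nodeAt (u q) , Q) ∈ links c (nodeAt (u p) , P))
                            (≡.sym (direction-forward 1 (toℕ p) q≡)) (≡.sym (direction-backward 1 (toℕ q) p≢))
                            (outer-forward-link q≡)
  ... | no q≢  | yes p≡ = subst₂ (λ P Q → (nodeAt (u q) , Q) ∈ links c (nodeAt (u p) , P))
                            (≡.sym (direction-backward 1 (toℕ p) q≢)) (≡.sym (direction-forward 1 (toℕ q) p≡))
                            (outer-backward-link p≡)
  ... | no q≢  | no p≢  = ⊥-elim ([ q≢ , p≢ ] p~q)
  link {v p} {v q} p~q with toℕ q ≟ (toℕ p + k) % n | toℕ p ≟ (toℕ q + k) % n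
  ... | yes q≡ | yes p≡ = subst₂ (λ P Q → (nodeAt (v q) , Q) ∈ links c (nodeAt (v p) , P))
                            (≡.sym (direction-forward k (toℕ p) q≡)) (≡.sym (direction-forward k (toℕ q) p≡))
                            (inner-doubled-link (step-both-ways⇒n≡d+d k n (toℕ<n p) 1≤k k+k≤n q≡ p≡) q≡)
  ... | yes q≡ | no p≢  = subst₂ (λ P Q → (nodeAt (v q) , Q) ∈ links c (nodeAt (v p) , P))
                            (≡.sym (direction-forward k (toℕ p) q≡)) (≡.sym (direction-backward k (toℕ q) p≢))
                            (inner-forward-link (λ n≡k+k → p≢ (n≡d+d⇒step-back k n n≡k+k (toℕ<n p) q≡)) q≡)
  ... | no q≢  | yes p≡ = subst₂ (λ P Q → (nodeAt (v q) , Q) ∈ links c (nodeAt (v p) , P))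
                            (≡.sym (direction-backward k (toℕ p) q≢)) (≡.sym (direction-forward k (toℕ q) p≡))
                            (inner-backward-link (λ n≡k+k → q≢ (n≡d+d⇒step-back k n n≡k+k (toℕ<n q) p≡)) p≡)
  ... | no q≢  | no p≢  = ⊥-elim ([ q≢ , p≢ ] p~q)

  turn : ∀ {x y z} → Adj n k x y → Adj n k x z → y ≢ z → dart x z ∈ turns (dart x y)
  turn x~y x~z y≢z = ∈-turns (y≢z ∘ port-injective x~y x~z)

  dart∈darts : ∀ x y → dart x y ∈ darts
  dart∈darts x y = ∈-darts (dart x y)

  starEdgeColouring : StarEdgeColouring5 n k
  starEdgeColouring = record
    { colouring = φ
    ; proper    = lifted-proper
    ; star      = noBicoloured4 φ lifted-proper lifted-noAlternating
    }
    where
    open Pattern.Lift c (valid c) (Adj n k) Adj-sym dart dart∈darts link turn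
    φ : EdgeColouring n k 5
    φ = record { col = lifted ; sym = lifted-sym }

-- Consequences of the hypotheses

2∣a⇒a≡b+b : ∀ {a} → 2 ∣ a → ∃[ b ] a ≡ b + b
2∣a⇒a≡b+b (divides b a≡b*2) = b , trans a≡b*2 (trans (*-comm b 2) (cong (b +_) (+-identityʳ b)))

a+a+0≡r⇒a≡⌊r/2⌋ : ∀ {a r} → a + a + 0 ≡ r → a ≡ ⌊ r /2⌋
a+a+0≡r⇒a≡⌊r/2⌋ {a} e = trans (≡.sym (⌊[a+a+bit]/2⌋≡a a 0ℙ)) (cong ⌊_/2⌋ e)

1≤h+h⇒2≤h+h : ∀ {h} → 1 ≤ h + h → 2 ≤ h + h
1≤h+h⇒2≤h+h {suc h} _ = s≤s (subst (1 ≤_) (≡.sym (+-suc h h)) (s≤s z≤n))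

a+a≤b+b⇒a≤b : ∀ {a b} → a + a ≤ b + b → a ≤ b
a+a≤b+b⇒a≤b a+a≤b+b = ≮⇒≥ λ b<a → <⇒≱ (+-mono-< b<a b<a) a+a≤b+b

m%3≡⌊n%6/2⌋ : ∀ {n m} → n ≡ m + m → m % 3 ≡ ⌊ n % 6 /2⌋
m%3≡⌊n%6/2⌋ {n} {m} n≡m+m = a+a+0≡r⇒a≡⌊r/2⌋ (begin
  m % 3 + m % 3 + 0   ≡⟨ [a+a+bit]%[m+m]≡ {6} {3} refl m 0ℙ ⟨
  (m + m + 0) % 6     ≡⟨ cong (_% 6) (trans (+-identityʳ (m + m)) (≡.sym n≡m+m)) ⟩
  n % 6               ∎)
  where open ≡.≡-Reasoning

m%3≡r⇒m≢2 : ∀ {m r} → m % 3 ≡ r → r ≢ 2 → m ≢ 2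
m%3≡r⇒m≢2 m%3≡r r≢2 refl = r≢2 (≡.sym m%3≡r)

residues-mod-3 : ∀ x → x % 3 ≡ 0 ⊎ x % 3 ≡ 1 ⊎ x % 3 ≡ 2
residues-mod-3 x with x % 3 | m%n<n x 3
... | 0 | _ = inj₁ refl
... | 1 | _ = inj₂ (inj₁ refl)
... | 2 | _ = inj₂ (inj₂ refl)
... | suc (suc (suc _)) | s≤s (s≤s (s≤s ()))

[tk]%n≡2⇒[ht]%m≡1 : ∀ {n m k h} t .{{_ : NonZero n}} .{{_ : NonZero m}} → n ≡ m + m → k ≡ h + h → 2 < n →
  (t * k) % n ≡ 2 % n → (h * t) % m ≡ 1
[tk]%n≡2⇒[ht]%m≡1 {n} {m} {k} {h} t n≡m+m k≡h+h 2<n tk≡2 = a+a+0≡r⇒a≡⌊r/2⌋ (begin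
  (h * t) % m + (h * t) % m + 0 ≡⟨ [a+a+bit]%[m+m]≡ n≡m+m (h * t) 0ℙ ⟨
  (h * t + h * t + 0) % n       ≡⟨ cong (_% n) (regroup t h) ⟩
  (t * (h + h)) % n             ≡⟨ cong (λ x → (t * x) % n) k≡h+h ⟨
  (t * k) % n                   ≡⟨ tk≡2 ⟩
  2 % n                         ≡⟨ m<n⇒m%n≡m 2<n ⟩
  2                             ∎)
  where
  open ≡.≡-Reasoning
  regroup : ∀ t h → h * t + h * t + 0 ≡ t * (h + h)
  regroup = solve-∀

-- If m ≤ t then (t ∸ m) k ≡ t k ≡ 2 (mod n), because m k = h n; so t ∸ m is neither 0 nor, by
-- minimality, positive.
minimal⇒t<m : ∀ {n m k h t} .{{_ : NonZero n}} → n ≡ m + m → k ≡ h + h → 2 < n → 1 ≤ m →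
  (t * k) % n ≡ 2 % n → (∀ s → 1 ≤ s → s < t → (s * k) % n ≢ 2 % n) → t < m
minimal⇒t<m {n} {m} {k} {h} {t} n≡m+m k≡h+h 2<n 1≤m tk≡2 minimal with t <? m
... | yes t<m = t<m
... | no t≮m  = contradiction sk≡2 (minimal s (n≢0⇒n>0 s≢0) (∸-monoʳ-< 1≤m m≤t))
  where
  open ≡.≡-Reasoning
  m≤t = ≮⇒≥ t≮m
  s = t ∸ m
  regroup : ∀ s m h → s * (h + h) + h * (m + m) ≡ (s + m) * (h + h)
  regroup = solve-∀
  sk≡2 : (s * k) % n ≡ 2 % n
  sk≡2 = begin
    (s * k) % n                   ≡⟨ [m+kn]%n≡m%n (s * k) h n ⟨
    (s * k + h * n) % n           ≡⟨ cong (_% n) (cong₂ (λ a b → s * a + h * b) k≡h+h n≡m+m) ⟩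
    (s * (h + h) + h * (m + m)) % n ≡⟨ cong (_% n) (regroup s m h) ⟩
    ((s + m) * (h + h)) % n       ≡⟨ cong (_% n) (cong₂ _*_ (m∸n+n≡m m≤t) (≡.sym k≡h+h)) ⟩
    (t * k) % n                   ≡⟨ tk≡2 ⟩
    2 % n                         ∎
  s≢0 : s ≢ 0
  s≢0 s≡0 = contradiction (begin
    0                             ≡⟨ m<n⇒m%n≡m (>-nonZero⁻¹ n) ⟨
    0 % n                         ≡⟨ cong (λ x → (x * k) % n) s≡0 ⟨
    (s * k) % n                   ≡⟨ sk≡2 ⟩
    2 % n                         ≡⟨ m<n⇒m%n≡m 2<n ⟩
    2                             ∎) λ ()

gcd≡2∧n≡k+k⇒k≡2 : ∀ {n k} → gcd n k ≡ 2 → 2 ≤ k → n ≡ k + k → k ≡ 2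
gcd≡2∧n≡k+k⇒k≡2 {n} {k} gcd≡2 2≤k n≡k+k = ≤-antisym (∣⇒≤ k∣2) 2≤k
  where
  k∣n : k ∣ n
  k∣n = divides 2 (trans n≡k+k (cong (k +_) (≡.sym (+-identityʳ k))))
  k∣2 : k ∣ 2
  k∣2 = subst (k ∣_) gcd≡2 (gcd-greatest k∣n ∣-refl)

3∣m∧[ht]%m≡1⇒t%3≢0 : ∀ {m h t} .{{_ : NonZero m}} → m % 3 ≡ 0 → (h * t) % m ≡ 1 → t % 3 ≢ 0
3∣m∧[ht]%m≡1⇒t%3≢0 {m} {h} {t} m%3≡0 ht≡1 t%3≡0 = contradiction (begin
  1                         ≡⟨ cong (_% 3) ht≡1 ⟨
  (h * t) % m % 3           ≡⟨ m∣n⇒o%n%m≡o%m 3 m (h * t) (m%n≡0⇒n∣m m 3 m%3≡0) ⟩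
  (h * t) % 3               ≡⟨ %-distribˡ-* h t 3 ⟩
  (h % 3 * (t % 3)) % 3     ≡⟨ cong (λ x → (h % 3 * x) % 3) t%3≡0 ⟩
  (h % 3 * 0) % 3           ≡⟨ cong (_% 3) (*-zeroʳ (h % 3)) ⟩
  0                         ∎) λ ()
  where open ≡.≡-Reasoning

module Construction {n k m h t : ℕ} .{{_ : NonZero n}} .{{_ : NonZero m}}
  (n≡m+m : n ≡ m + m) (k≡h+h : k ≡ h + h) (2≤m : 2 ≤ m) (2≤k : 2 ≤ k) (k+k≤n : k + k ≤ n)
  (gcd≡2 : gcd n k ≡ 2) (1≤t : 1 ≤ t) (tk≡2 : (t * k) % n ≡ 2 % n)
  (minimal : ∀ s → 1 ≤ s → s < t → (s * k) % n ≢ 2 % n) where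

  4≤n : 4 ≤ n
  4≤n = subst (4 ≤_) (≡.sym n≡m+m) (+-mono-≤ 2≤m 2≤m)

  2<n : 2 < n
  2<n = ≤-trans (n≤1+n 3) 4≤n

  ht≡1 : (h * t) % m ≡ 1
  ht≡1 = [tk]%n≡2⇒[ht]%m≡1 {h = h} t n≡m+m k≡h+h 2<n tk≡2

  t<m : t < m
  t<m = minimal⇒t<m {h = h} n≡m+m k≡h+h 2<n (≤-trans (n≤1+n 1) 2≤m) tk≡2 minimal

  doubled⇒m≡2 : n ≡ k + k → m ≡ 2
  doubled⇒m≡2 n≡k+k = a+a+0≡r⇒a≡⌊r/2⌋ (begin
    m + m + 0     ≡⟨ +-identityʳ (m + m) ⟩
    m + m         ≡⟨ n≡m+m ⟨
    n             ≡⟨ n≡k+k ⟩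
    k + k         ≡⟨ cong (λ x → x + x) (gcd≡2∧n≡k+k⇒k≡2 gcd≡2 2≤k n≡k+k) ⟩
    4             ∎)
    where open ≡.≡-Reasoning

  open Covering {t = t} {h = h} n≡m+m 4≤n k≡h+h ht≡1 (≤-trans (n≤1+n 1) 2≤k) k+k≤n

  viaResidues : ∀ c {μ τ} → outerLink c ≡ outerStep μ τ → innerLink c ≡ innerStep μ →
    m % 3 ≡ μ → t % 3 ≡ τ → m ≢ 2 → StarEdgeColouring5 n k
  viaResidues c outer≡ inner≡ refl refl m≢2 = starEdgeColouring c
    (λ j<m → subst (λ R → T (R _ _)) (≡.sym outer≡) (outerStep-label 2≤m 1≤t t<m j<m))
    (λ _ j<m → subst (λ R → T (R _ _)) (≡.sym inner≡) (innerStep-label (≤∧≢⇒< 2≤m (m≢2 ∘ ≡.sym)) j<m))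
    (λ n≡k+k → contradiction (doubled⇒m≡2 n≡k+k) m≢2)

  viaGP[4,2] : m ≡ 2 → StarEdgeColouring5 n k
  viaGP[4,2] m≡2 = starEdgeColouring gp42
    (swapsF0E1-label m≡2 t≡1)
    (λ n≢k+k → contradiction n≡k+k n≢k+k)
    (λ _ → swapsF0E1-label m≡2 refl)
    where
    n≡4 : n ≡ 4
    n≡4 = trans n≡m+m (cong (λ x → x + x) m≡2)
    k≡2 : k ≡ 2
    k≡2 = ≤-antisym (a+a≤b+b⇒a≤b (subst (k + k ≤_) n≡4 k+k≤n)) 2≤k
    n≡k+k : n ≡ k + k
    n≡k+k = trans n≡4 (cong (λ x → x + x) (≡.sym k≡2))
    t≡1 : t ≡ 1
    t≡1 = ≤-antisym (s≤s⁻¹ (subst (t <_) m≡2 t<m)) 1≤t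

  m%3≡⌊r/2⌋ : ∀ {r} → n % 6 ≡ r → m % 3 ≡ ⌊ r /2⌋
  m%3≡⌊r/2⌋ n%6≡r = trans (m%3≡⌊n%6/2⌋ {m = m} n≡m+m) (cong ⌊_/2⌋ n%6≡r)

  via3∣m : m % 3 ≡ 0 → StarEdgeColouring5 n k
  via3∣m m%3≡0 with residues-mod-3 t
  ... | inj₁ t%3≡0        = contradiction t%3≡0 (3∣m∧[ht]%m≡1⇒t%3≢0 {h = h} m%3≡0 ht≡1)
  ... | inj₂ (inj₁ t%3≡1) = viaResidues μ0τ1 refl refl m%3≡0 t%3≡1 (m%3≡r⇒m≢2 m%3≡0 λ ())
  ... | inj₂ (inj₂ t%3≡2) = viaResidues μ0τ2 refl refl m%3≡0 t%3≡2 (m%3≡r⇒m≢2 m%3≡0 λ ())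

  byCases : (n % 6 ≡ 0) ⊎ (n % 6 ≡ 2 × t % 3 ≡ 2) ⊎ (n % 6 ≡ 4 × t % 3 ≡ 1) → StarEdgeColouring5 n k
  byCases (inj₁ n%6≡0) = via3∣m (m%3≡⌊r/2⌋ n%6≡0)
  byCases (inj₂ (inj₁ (n%6≡2 , t%3≡2))) =
    viaResidues μ1τ2 refl refl (m%3≡⌊r/2⌋ n%6≡2) t%3≡2 (m%3≡r⇒m≢2 (m%3≡⌊r/2⌋ n%6≡2) λ ())
  byCases (inj₂ (inj₂ (n%6≡4 , t%3≡1))) with m ≟ 2
  ... | yes m≡2 = viaGP[4,2] m≡2
  ... | no m≢2  = viaResidues μ2τ1 refl refl (m%3≡⌊r/2⌋ n%6≡4) t%3≡1 m≢2

theorem2 : (n k : ℕ) → .{{_ : NonZero n}} → 1 ≤ k → 2 * k ≤ n → gcd n k ≡ 2 →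
    (t : ℕ) → 1 ≤ t → (t * k) % n ≡ 2 % n →
    (∀ s → 1 ≤ s → s < t → (s * k) % n ≢ 2 % n) →
    ((n % 6 ≡ 0) ⊎ (n % 6 ≡ 2 × t % 3 ≡ 2) ⊎ (n % 6 ≡ 4 × t % 3 ≡ 1)) →
    StarEdgeColouring5 n k
theorem2 n k 1≤k 2k≤n gcd≡2 t 1≤t tk≡2 minimal cases
  with 2∣a⇒a≡b+b (subst (_∣ n) gcd≡2 (gcd[m,n]∣m n k)) | 2∣a⇒a≡b+b (subst (_∣ k) gcd≡2 (gcd[m,n]∣n n k))
... | m , n≡m+m | h , k≡h+h = byCases cases
  where
  k+k≤n : k + k ≤ n
  k+k≤n = subst (_≤ n) (cong (k +_) (+-identityʳ k)) 2k≤n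
  2≤k : 2 ≤ k
  2≤k = subst (2 ≤_) (≡.sym k≡h+h) (1≤h+h⇒2≤h+h {h} (subst (1 ≤_) k≡h+h 1≤k))
  2≤m : 2 ≤ m
  2≤m = a+a≤b+b⇒a≤b (subst (4 ≤_) n≡m+m (≤-trans (+-mono-≤ 2≤k 2≤k) k+k≤n))
  instance
    _ : NonZero m
    _ = >-nonZero (≤-trans (n≤1+n 1) 2≤m)
  open Construction {h = h} n≡m+m k≡h+h 2≤m 2≤k k+k≤n gcd≡2 1≤t tk≡2 minimal
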